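{- Let $G$ be a connected graph of order $n\ge 3$. Then $\beta_p(G)\le \eta_p(G)\le \beta_p(G)+1$.
   Context: All graphs are finite, simple, undirected and connected. For a vertex $v$ and a set $S\subseteq V(G)$, $d(v,S)=\min\{d(v,w):w\in S\}$. For a partition $\Pi=\{S_1,\dots,S_k\}$ of $V(G)$ and $u\in V(G)$, let $r(u|\Pi)=(d(u,S_1),\dots,d(u,S_k))$. $\Pi$ is a resolving partition if $r(u|\Pi)\ne r(v|\Pi)$ for all distinct $u,v\in V(G)$. $\Pi$ is a dominating partition if for every $v\in V(G)$ there is $j$ with $d(v,S_j)=1$. A resolving dominating partition (RD-partition) is a partition that is both resolving and dominating. The partition dimension $\beta_p(G)$ is the minimum cardinality of a resolving partition of $G$; the dominating partition dimension $\eta_p(G)$ is the minimum cardinality of an RD-partition of $G$. -}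

module Defs where

open import Data.Nat using (ℕ; zero; suc; _≤_)
open import Data.Fin using (Fin)
open import Data.Product using (Σ; ∃; _×_; _,_)
open import Function.Definitions using (Surjective)
open import Relation.Binary.PropositionalEquality using (_≡_)
open import Relation.Nullary using (¬_)

record Graph (n : ℕ) : Set₁ where
  field
    Adj    : Fin n → Fin n → Set
    sym    : ∀ {u v} → Adj u v → Adj v u
    irrefl : ∀ {u} → ¬ Adj u u

open Graph public

data Walk {n : ℕ} (G : Graph n) : Fin n → Fin n → ℕ → Set where
  here : ∀ {u} → Walk G u u 0
  step : ∀ {u v w k} → Adj G u v → Walk G v w k → Walk G u w (suc k)

Connected : ∀ {n} → Graph n → Set
Connected G = ∀ u v → ∃ λ k → Walk G u v k

Dist : ∀ {n} → Graph n → Fin n → Fin n → ℕ → Set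
Dist G u v d = Walk G u v d × (∀ m → Walk G u v m → d ≤ m)

-- A partition of V(G) into k classes: a surjective class map c : Fin n → Fin k
-- (class S_j = { w | c w ≡ j }, each class nonempty).
Partition : ℕ → ℕ → Set
Partition n k = Σ (Fin n → Fin k) λ c → Surjective _≡_ _≡_ c

DistSet : ∀ {n k} → Graph n → (Fin n → Fin k) → Fin n → Fin k → ℕ → Set
DistSet {n} G c v j d =
  (Σ (Fin n) λ w → c w ≡ j × Dist G v w d)
  × (∀ w e → c w ≡ j → Dist G v w e → d ≤ e)

SameRep : ∀ {n k} → Graph n → (Fin n → Fin k) → Fin n → Fin n → Set
SameRep G c u v = ∀ j d → (DistSet G c u j d → DistSet G c v j d)
                        × (DistSet G c v j d → DistSet G c u j d)

Resolving : ∀ {n k} → Graph n → Partition n k → Set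
Resolving G (c , _) = ∀ u v → SameRep G c u v → u ≡ v

Dominating : ∀ {n k} → Graph n → Partition n k → Set
Dominating G (c , _) = ∀ v → Σ _ λ j → DistSet G c v j 1

IsPartitionDimension : ∀ {n} → Graph n → ℕ → Set
IsPartitionDimension {n} G b =
  (Σ (Partition n b) λ P → Resolving G P)
  × (∀ k (P : Partition n k) → Resolving G P → b ≤ k)

IsDominatingPartitionDimension : ∀ {n} → Graph n → ℕ → Set
IsDominatingPartitionDimension {n} G e =
  (Σ (Partition n e) λ P → Resolving G P × Dominating G P)
  × (∀ k (P : Partition n k) → Resolving G P → Dominating G P → e ≤ k)

module Submission where

-- The lower bound holds because every RD-partition is resolving.  For the
-- upper bound take a resolving partition c with b classes S_j and call a
-- vertex undominated when all its neighbours lie in its own class; c is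
-- dominating exactly when no vertex is undominated.  Otherwise choose a
-- maximal independent set T among the undominated vertices and refine c into
-- the b + 1 classes T and S_j \ T.  Every neighbour of a vertex of T lies in
-- the same class and outside T, so from a vertex u not in S_j ∩ T a closest
-- vertex of S_j can be taken outside T: d(u, S_j) = d(u, S_j \ T).  Together
-- with the new class T this makes the refinement resolving, and independence
-- and maximality of T make it dominating.
--
-- The construction needs decidable adjacency, which the graphs of Defs do not
-- provide.  Since the goal e ≤ b + 1 is decidable, it suffices to prove it
-- under the (classically valid, hence not refutable) assumption that
-- adjacency is decidable.

open import Defs hiding (sym)
open import Data.Nat using (ℕ; zero; suc; _≤_; _<_; z≤n; s≤s; _≤?_)
open import Data.Nat.Properties using (≤-refl; ≤-trans; n≤1+n; 1+n≰n; n≤0⇒n≡0; ≮⇒≥)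
open import Data.Nat.Induction using (<-rec)
open import Data.Fin using (Fin; zero; suc; toℕ; fromℕ<)
open import Data.Fin.Properties using (_≟_; any?; all?; ¬∀⟶∃¬; 0≢1+n; suc-injective; toℕ<n; toℕ-fromℕ<; sequence)
open import Data.Bool using (Bool; true; false; if_then_else_)
open import Data.Bool.Properties using (¬-not) renaming (_≟_ to _≟ᵇ_)
open import Data.Vec.Functional using (_∷_)
open import Data.Product using (Σ; ∃; _×_; _,_; proj₁; proj₂; swap)
open import Data.Empty using (⊥-elim)
open import Function using (_∘_)
open import Function.Definitions using (Surjective; StrictlySurjective)
open import Function.Consequences.Propositional using (strictlySurjective⇒surjective)
open import Relation.Nullary using (¬_; Dec; yes; no; contradiction)
open import Relation.Nullary.Decidable using (decidable-stable; ¬¬-excluded-middle; _×-dec_; _→-dec_)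
open import Relation.Nullary.Negation using (¬¬-Monad; ¬¬-map)
open import Effect.Applicative using (RawApplicative)
open import Effect.Monad using (RawMonad)
open import Relation.Binary.PropositionalEquality using (_≡_; _≢_; refl; sym; trans; subst; cong)

-- Classically every relation on a finite set is decidable; constructively
-- this holds up to double negation (excluded middle, pointwise, collected
-- over the finitely many pairs).
¬¬-decidable : ∀ {n} (R : Fin n → Fin n → Set) → ¬ ¬ (∀ u v → Dec (R u v))
¬¬-decidable R =
  sequence ¬¬-applicative λ u → sequence ¬¬-applicative λ v → ¬¬-excluded-middle
  where
  ¬¬-applicative : RawApplicative (λ (A : Set) → ¬ ¬ A)
  ¬¬-applicative = RawMonad.rawApplicative ¬¬-Monad

record MaximalIndependent {n} (R : Fin n → Fin n → Set) (P : Fin n → Set)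
                          (T : Fin n → Bool) : Set where
  field
    inside      : ∀ {u} → T u ≡ true → P u
    independent : ∀ {u w} → T u ≡ true → T w ≡ true → ¬ R u w
    maximal     : ∀ {u} → P u → T u ≡ false → ∃ λ w → T w ≡ true × R u w

module Extend {n} (R : Fin (suc n) → Fin (suc n) → Set) (P : Fin (suc n) → Set)
              (R-sym : ∀ {u w} → R u w → R w u) (R-irrefl : ∀ {u} → ¬ R u u)
              {T : Fin n → Bool}
              (T-mis : MaximalIndependent (λ i j → R (suc i) (suc j)) (P ∘ suc) T) where
  open MaximalIndependent T-mis

  leaveOut : (P zero → ∃ λ i → T i ≡ true × R zero (suc i)) →
             MaximalIndependent R P (false ∷ T)
  leaveOut covered = record
    { inside      = λ { {suc u} t → inside t }
    ; independent = λ { {suc u} {suc w} → independent }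
    ; maximal     = λ { {zero} p _ → let i , t , r = covered p in suc i , t , r
                      ; {suc u} p f → let w , t , r = maximal p f in suc w , t , r }
    }

  putIn : P zero → (∀ i → T i ≡ true → ¬ R zero (suc i)) →
          MaximalIndependent R P (true ∷ T)
  putIn p₀ isolated = record
    { inside      = λ { {zero} _ → p₀ ; {suc u} t → inside t }
    ; independent = λ { {zero} {zero} _ _ → R-irrefl
                      ; {zero} {suc w} _ t → isolated w t
                      ; {suc u} {zero} t _ → isolated u t ∘ R-sym
                      ; {suc u} {suc w} → independent }
    ; maximal     = λ { {suc u} p f → let w , t , r = maximal p f in suc w , t , r }
    }

maximalIndependent : ∀ {n} (R : Fin n → Fin n → Set) → (∀ u w → Dec (R u w)) →
  (∀ {u w} → R u w → R w u) → (∀ {u} → ¬ R u u) →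
  (P : Fin n → Set) → (∀ u → Dec (P u)) → ∃ (MaximalIndependent R P)
maximalIndependent {zero} R R? R-sym R-irrefl P P? =
  (λ ()) , record { inside = λ { {()} } ; independent = λ { {()} } ; maximal = λ { {()} } }
maximalIndependent {suc n} R R? R-sym R-irrefl P P?
  with maximalIndependent (λ i j → R (suc i) (suc j)) (λ i j → R? (suc i) (suc j))
                          R-sym R-irrefl (P ∘ suc) (P? ∘ suc)
... | T , T-mis
  with P? zero | any? (λ i → (T i ≟ᵇ true) ×-dec R? zero (suc i))
... | no ¬p₀ | _            = false ∷ T , leaveOut (⊥-elim ∘ ¬p₀)
  where open Extend R P R-sym R-irrefl T-mis
... | yes _  | yes covered  = false ∷ T , leaveOut (λ _ → covered)
  where open Extend R P R-sym R-irrefl T-mis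
... | yes p₀ | no uncovered = true ∷ T , putIn p₀ (λ i t r → uncovered (i , t , r))
  where open Extend R P R-sym R-irrefl T-mis

module Walks {n} (G : Graph n) where

  walk-zero : ∀ {u v} → Walk G u v 0 → u ≡ v
  walk-zero here = refl

  walk-one : ∀ {u v} → Walk G u v 1 → Adj G u v
  walk-one (step a here) = a

  walk-last : ∀ {u w d} → Walk G u w (suc d) → ∃ λ p → Walk G u p d × Adj G p w
  walk-last (step a here)         = _ , here , a
  walk-last (step a (step a′ r)) =
    let p , r′ , a″ = walk-last (step a′ r) in p , step a r′ , a″

  walk-leaves : ∀ {u v k} → Walk G u v k → u ≢ v → ∃ (Adj G u)
  walk-leaves here       u≢u = contradiction refl u≢u
  walk-leaves (step a _) _   = _ , a

  module _ (adj? : ∀ u v → Dec (Adj G u v)) where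

    walk? : ∀ u v k → Dec (Walk G u v k)
    walk? u v zero with u ≟ v
    ... | yes refl = yes here
    ... | no u≢v   = no (u≢v ∘ walk-zero)
    walk? u v (suc k) with any? (λ w → adj? u w ×-dec walk? w v k)
    ... | yes (_ , a , r) = yes (step a r)
    ... | no none         = no λ { (step a r) → none (_ , a , r) }

    shortestWalk : ∀ {u v} m → Walk G u v m → ∃ (Dist G u v)
    shortestWalk {u} {v} = <-rec (λ m → Walk G u v m → ∃ (Dist G u v)) shorten
      where
      shorten : ∀ m → (∀ {m′} → m′ < m → Walk G u v m′ → ∃ (Dist G u v)) →
                Walk G u v m → ∃ (Dist G u v)
      shorten m shorter r with any? (λ (k : Fin m) → walk? u v (toℕ k))
      ... | yes (k , r′) = shorter (toℕ<n k) r′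
      ... | no none      = m , r , λ m′ r′ → ≮⇒≥ λ m′<m →
            none (fromℕ< m′<m , subst (Walk G u v) (sym (toℕ-fromℕ< m′<m)) r′)

module ClassDistances {n k} (G : Graph n) (f : Fin n → Fin k) where
  open Walks G

  distance-zero : ∀ {x} → Dist G x x 0
  distance-zero = here , λ _ _ → z≤n

  inOwnClass : ∀ {x j} → f x ≡ j → DistSet G f x j 0
  inOwnClass {x} fx = (x , fx , distance-zero) , λ _ _ _ _ → z≤n

  ownClass-zero : ∀ {x j d} → f x ≡ j → DistSet G f x j d → d ≡ 0
  ownClass-zero {x} fx (_ , closest) = n≤0⇒n≡0 (closest x 0 fx distance-zero)

  zero-ownClass : ∀ {x j} → DistSet G f x j 0 → f x ≡ j
  zero-ownClass ((_ , fw , here , _) , _) = fw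

  adjacentClass : ∀ {x w j} → Adj G x w → f w ≡ j → f x ≢ j → DistSet G f x j 1
  adjacentClass {x} {w} {j} a fw fx≢j = (w , fw , step a here , nonEmpty) , notInClass
    where
    nonEmpty : ∀ m → Walk G x w m → 1 ≤ m
    nonEmpty .0 here        = contradiction a (irrefl G)
    nonEmpty _  (step _ _)  = s≤s z≤n
    notInClass : ∀ w′ e → f w′ ≡ j → Dist G x w′ e → 1 ≤ e
    notInClass w′ .0 fw′ (here , _)     = contradiction fw′ fx≢j
    notInClass w′ _  _   (step _ _ , _) = s≤s z≤n

  distSet-≤-walk : (∀ u v → Dec (Adj G u v)) →
    ∀ {u w j d m} → DistSet G f u j d → f w ≡ j → Walk G u w m → d ≤ m
  distSet-≤-walk adj? {m = m} (_ , closest) fw r =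
    let e , dist = shortestWalk adj? m r in ≤-trans (closest _ e fw dist) (proj₂ dist m r)

  SameDistanceTo : Fin n → Fin n → Fin k → Set
  SameDistanceTo u v j = ∀ d → (DistSet G f u j d → DistSet G f v j d)
                             × (DistSet G f v j d → DistSet G f u j d)

  sameRep-sym : ∀ {u v} → SameRep G f u v → SameRep G f v u
  sameRep-sym same j d = swap (same j d)

  sameClass-sameDistance : ∀ {u v j} → f u ≡ j → f v ≡ j → SameDistanceTo u v j
  sameClass-sameDistance fu fv d =
      (λ D → subst (DistSet G f _ _) (sym (ownClass-zero fu D)) (inOwnClass fv))
    , (λ D → subst (DistSet G f _ _) (sym (ownClass-zero fv D)) (inOwnClass fu))

-- u is undominated by f when all its neighbours lie in its own class, i.e.
-- no class is at distance exactly 1 from u.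
Undominated : ∀ {n k} → Graph n → (Fin n → Fin k) → Fin n → Set
Undominated G f u = ∀ w → Adj G u w → f w ≡ f u

module Domination {n k} (G : Graph n) (adj? : ∀ u v → Dec (Adj G u v))
                  (f : Fin n → Fin k) where
  open ClassDistances G f

  undominated? : ∀ u → Dec (Undominated G f u)
  undominated? u = all? (λ w → adj? u w →-dec (f w ≟ f u))

  dominated-witness : ∀ {u} → ¬ Undominated G f u → ∃ λ w → Adj G u w × f w ≢ f u
  dominated-witness {u} ¬U with ¬∀⟶∃¬ n _ (λ w → adj? u w →-dec (f w ≟ f u)) ¬U
  ... | w , ¬edge⇒same with adj? u w
  ...   | yes a  = w , a , λ same → ¬edge⇒same (λ _ → same)
  ...   | no ¬a  = contradiction (λ a → contradiction a ¬a) ¬edge⇒same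

  dominating-without-undominated : (∀ u → ¬ Undominated G f u) →
    ∀ v → ∃ λ j → DistSet G f v j 1
  dominating-without-undominated none v =
    let w , a , fw≢fv = dominated-witness (none v)
    in f w , adjacentClass a refl (fw≢fv ∘ sym)

module Refinement {n b} (G : Graph n) (adj? : ∀ u v → Dec (Adj G u v))
                  (hasNeighbour : ∀ u → ∃ (Adj G u))
                  (c : Fin n → Fin b) (T : Fin n → Bool)
                  (T-mis : MaximalIndependent (Adj G) (Undominated G c) T) where
  open MaximalIndependent T-mis
  open Walks G
  open Domination G adj? c
  module C = ClassDistances G c

  refine : Fin n → Fin (suc b)
  refine v = if T v then zero else suc (c v)

  module R = ClassDistances G refine

  inT : ∀ {v} → T v ≡ true → refine v ≡ zero
  inT t rewrite t = refl

  notInT : ∀ {v} → T v ≡ false → refine v ≡ suc (c v)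
  notInT f rewrite f = refl

  refine-zero⁻¹ : ∀ {v} → refine v ≡ zero → T v ≡ true
  refine-zero⁻¹ {v} e with T v
  ... | true  = refl
  ... | false = contradiction (sym e) 0≢1+n

  refine-suc⁻¹ : ∀ {v j} → refine v ≡ suc j → T v ≡ false × c v ≡ j
  refine-suc⁻¹ {v} e with T v
  ... | true  = contradiction e 0≢1+n
  ... | false = refl , suc-injective e

  -- Neighbours of a vertex of T are outside T (independence) and in the
  -- same class (T consists of undominated vertices).
  neighbour-of-T : ∀ {u w} → T u ≡ true → Adj G w u → T w ≡ false × c w ≡ c u
  neighbour-of-T tu a = ¬-not (λ tw → independent tw tu a) , inside tu _ (Graph.sym G a)

  -- u does not belong to S_j ∩ T.
  Outside : Fin n → Fin b → Set
  Outside u j = T u ≡ true → c u ≢ j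

  notInT-outside : ∀ {u j} → T u ≡ false → Outside u j
  notInT-outside f t = contradiction (trans (sym t) f) λ ()

  stepBack : ∀ {u w m} → T w ≡ true → Walk G u w (suc m) →
             ∃ λ p → Walk G u p m × T p ≡ false × c p ≡ c w
  stepBack tw r = let p , r′ , a = walk-last r in p , r′ , neighbour-of-T tw a

  noEmptyWalk : ∀ {u w j} → Outside u j → T w ≡ true → c w ≡ j → ¬ Walk G u w 0
  noEmptyWalk out tw cw here = out tw cw

  closest-notInT : ∀ {u w j d} → Outside u j → DistSet G c u j d → c w ≡ j →
                   Walk G u w d → T w ≢ true
  closest-notInT {d = zero}  out _ cw r tw = noEmptyWalk out tw cw r
  closest-notInT {d = suc d} _   D cw r tw =
    let _ , r′ , _ , cp = stepBack tw r
    in 1+n≰n (C.distSet-≤-walk adj? D (trans cp cw) r′)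

  reach-outside-T : ∀ {u w j e} → Outside u j → c w ≡ j → Walk G u w e →
    ∃ λ m → m ≤ e × ∃ λ p → refine p ≡ suc j × Walk G u p m
  reach-outside-T {w = w} {e = e} out cw r with T w in tw
  ... | false = e , ≤-refl , w , trans (notInT tw) (cong suc cw) , r
  reach-outside-T {e = zero} out cw r  | true = contradiction r (noEmptyWalk out tw cw)
  reach-outside-T {e = suc e} out cw r | true =
    let p , r′ , tp , cp = stepBack tw r
    in e , n≤1+n e , p , trans (notInT tp) (cong suc (trans cp cw)) , r′

  transfer→ : ∀ {u j d} → Outside u j → DistSet G c u j d → DistSet G refine u (suc j) d
  transfer→ out D@((w , cw , dist) , closest) =
      (w , trans (notInT (¬-not (closest-notInT out D cw (proj₁ dist)))) (cong suc cw) , dist)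
    , λ w′ e rw′ → closest w′ e (proj₂ (refine-suc⁻¹ rw′))

  transfer← : ∀ {u j d} → Outside u j → DistSet G refine u (suc j) d → DistSet G c u j d
  transfer← out D@((w , rw , dist) , _) =
      (w , proj₂ (refine-suc⁻¹ rw) , dist)
    , λ w′ e cw′ dist′ →
        let m , m≤e , _ , rp , r = reach-outside-T out cw′ (proj₁ dist′)
        in ≤-trans (R.distSet-≤-walk adj? D rp r) m≤e

  transfer-same : ∀ {u v j} → Outside u j → Outside v j →
    R.SameDistanceTo u v (suc j) → C.SameDistanceTo u v j
  transfer-same ou ov same d =
      (λ D → transfer← ov (proj₁ (same d) (transfer→ ou D)))
    , (λ D → transfer← ou (proj₂ (same d) (transfer→ ov D)))

  T-separates : ∀ {u v} → SameRep G refine u v → T u ≡ true → T v ≡ true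
  T-separates same tu =
    refine-zero⁻¹ (R.zero-ownClass (proj₁ (same zero 0) (R.inOwnClass (inT tu))))

  -- Two vertices of T with the same representation lie in the same class of c:
  -- a neighbour of u puts S_{c u} \ T at distance 1, and the vertex of S_{c u} \ T
  -- adjacent to v lies in v's class.
  T-sameClass : ∀ {u v} → SameRep G refine u v → T u ≡ true → T v ≡ true → c u ≡ c v
  T-sameClass {u} same tu tv =
    let w , a = hasNeighbour u
        tw , cw = neighbour-of-T tu (Graph.sym G a)
        D = R.adjacentClass a (trans (notInT tw) (cong suc cw))
                            (λ e → 0≢1+n (trans (sym (inT tu)) e))
        (w′ , rw′ , r , _) , _ = proj₁ (same (suc (c u)) 1) D
    in trans (sym (proj₂ (refine-suc⁻¹ rw′))) (inside tv w′ (walk-one r))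

  refine-resolving : (∀ u v → SameRep G c u v → u ≡ v) →
                     ∀ u v → SameRep G refine u v → u ≡ v
  refine-resolving res u v same with T u in tu | T v in tv
  ... | false | false = res u v λ j →
        transfer-same (notInT-outside tu) (notInT-outside tv) (same (suc j))
  ... | true  | false = contradiction (trans (sym (T-separates same tu)) tv) λ ()
  ... | false | true  =
        contradiction (trans (sym (T-separates (R.sameRep-sym same) tv)) tu) λ ()
  ... | true  | true  = res u v sameRep
    where
    cu≡cv : c u ≡ c v
    cu≡cv = T-sameClass same tu tv
    sameRep : SameRep G c u v
    sameRep j with j ≟ c u
    ... | yes refl = C.sameClass-sameDistance refl (sym cu≡cv)
    ... | no j≢cu  = transfer-same (λ _ → j≢cu ∘ sym) (λ _ → j≢cu ∘ sym ∘ trans cu≡cv)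
                                   (same (suc j))

  -- Vertices of T see a neighbour outside T; undominated vertices outside T
  -- see T (maximality); other vertices see a neighbour in another class of c,
  -- which is either in T or in another class of the refinement.
  refine-dominating : ∀ v → ∃ λ j → DistSet G refine v j 1
  refine-dominating v with T v in tv
  ... | true = let w , a = hasNeighbour v
                   tw , _ = neighbour-of-T tv (Graph.sym G a)
               in suc (c w) , R.adjacentClass a (notInT tw) (λ e → 0≢1+n (trans (sym (inT tv)) e))
  ... | false with undominated? v
  ...   | yes undominated =
          let w , tw , a = maximal undominated tv
          in zero , R.adjacentClass a (inT tw) (λ e → 0≢1+n (trans (sym e) (notInT tv)))
  ...   | no dominated with dominated-witness dominated
  ...     | w , a , cw≢cv with T w in tw
  ...       | true  = zero , R.adjacentClass a (inT tw)
                               (λ e → 0≢1+n (trans (sym e) (notInT tv)))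
  ...       | false = suc (c w) , R.adjacentClass a (notInT tw)
                               (λ e → cw≢cv (sym (suc-injective (trans (sym (notInT tv)) e))))

  -- Class zero is nonempty as soon as some vertex is undominated; a vertex of
  -- S_j in T is replaced by one of its neighbours, which is in S_j \ T.
  refine-surjective : Surjective _≡_ _≡_ c → ∃ (Undominated G c) →
                      Surjective _≡_ _≡_ refine
  refine-surjective surj (u₀ , undominated) = strictlySurjective⇒surjective hit
    where
    hit : StrictlySurjective _≡_ refine
    hit zero with T u₀ in t₀
    ... | true  = u₀ , inT t₀
    ... | false = let w , tw , _ = maximal undominated t₀ in w , inT tw
    hit (suc j) with surj j
    ... | x , preimage with T x in tx
    ...   | false = x , trans (notInT tx) (cong suc (preimage refl))
    ...   | true  = let w , a = hasNeighbour x
                        tw , cw = neighbour-of-T tx (Graph.sym G a)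
                    in w , trans (notInT tw) (cong suc (trans cw (preimage refl)))

oneMoreClass : ∀ {n b} (G : Graph n) → (∀ u v → Dec (Adj G u v)) →
  (∀ u → ∃ (Adj G u)) → (P : Partition n b) → Resolving G P →
  ∃ λ k → k ≤ suc b × Σ (Partition n k) λ Q → Resolving G Q × Dominating G Q
oneMoreClass {b = b} G adj? hasNeighbour (c , surj) res
  with any? (Domination.undominated? G adj? c)
... | no none = b , n≤1+n b , (c , surj) , res ,
      Domination.dominating-without-undominated G adj? c (λ u U → none (u , U))
... | yes undominated =
  let T , T-mis = maximalIndependent (Adj G) adj? (Graph.sym G) (irrefl G)
                                     (Undominated G c) (Domination.undominated? G adj? c)
      open Refinement G adj? hasNeighbour c T T-mis
  in suc b , ≤-refl , (refine , refine-surjective surj undominated) ,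
     refine-resolving res , refine-dominating

hasNeighbour : ∀ {n} (G : Graph n) → 2 ≤ n → Connected G → ∀ u → ∃ (Adj G u)
hasNeighbour G (s≤s (s≤s _)) connected zero    =
  Walks.walk-leaves G (proj₂ (connected zero (suc zero))) λ ()
hasNeighbour G (s≤s (s≤s _)) connected (suc u) =
  Walks.walk-leaves G (proj₂ (connected (suc u) zero)) λ ()

mainTheorem1 : ∀ (n : ℕ) → 3 ≤ n → (G : Graph n) → Connected G →
    ∀ (b e : ℕ) → IsPartitionDimension G b → IsDominatingPartitionDimension G e →
    b ≤ e × e ≤ suc b
mainTheorem1 n 3≤n G connected b e ((P , P-resolving) , β-minimal)
             ((Q , Q-resolving , _) , η-minimal) =
  β-minimal e Q Q-resolving ,
  decidable-stable (e ≤? suc b) (¬¬-map η-upper (¬¬-decidable (Adj G)))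
  where
  η-upper : (∀ u v → Dec (Adj G u v)) → e ≤ suc b
  η-upper adj? =
    let k , k≤1+b , R , R-resolving , R-dominating =
          oneMoreClass G adj? (hasNeighbour G (≤-trans (n≤1+n 2) 3≤n) connected) P P-resolving
    in ≤-trans (η-minimal k R R-resolving R-dominating) k≤1+b
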